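{- Let $\mathcal{B}_{\textsc{IPR}}=\{B_1,\dots,B_m\}$ be the partition returned by $\textsc{IPR}$ with $\rho=4$. With $b_{\max}$, $W$ and $\ell$ defined at termination as below, $b_{\max}\le\frac{2W}{\ell+1}$.
   Context: Jobs with processing times $p_j\ge0$, $p(B)=\sum_{j\in B}p_j$, $m$ machines with predicted speeds $\hat s_i>0$; $opt(\mathbf{p},\hat{\mathbf{s}})$ is the minimum makespan of scheduling the jobs with speeds $\hat{\mathbf{s}}$ (total processing time $P$ on machine $i$ takes time $P/\hat s_i$). Algorithm $\textsc{IPR}$ with inputs $\mathbf{p}$, $\hat{\mathbf{s}}$ ($\hat s_1\ge\cdots\ge\hat s_m$), $\alpha\in(0,1)$, accuracy $\epsilon\in(0,1)$, $\rho\ge1$: 1. Compute a partition $B_1,\dots,B_m$ with $p(B_1)\ge\cdots\ge p(B_m)$ and $\max_i p(B_i)/\hat s_i\le(1+\epsilon)\,opt(\mathbf{p},\hat{\mathbf{s}})$; set $\overline{\mathrm{OPT}}_C=\max_i p(B_i)/\hat s_i$ and $\mathcal{M}_i=\{B_i\}$. 2. While $\max\{p(B):B\in\cup_i\mathcal{M}_i,|B|\ge2\}>\rho\min\{p(B):B\in\cup_i\mathcal{M}_i\}$: let $(\mathcal{M}'_i)=\textsc{LPT-Rebalance}((\mathcal{M}_i))$; if $\max_i\sum_{B\in\mathcal{M}'_i}p(B)/\hat s_i>(1+\alpha)\overline{\mathrm{OPT}}_C$, return the bags in $\cup_i\mathcal{M}_i$; else set $\mathcal{M}_i\leftarrow\mathcal{M}'_i$.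 3. Return the bags in $\cup_i\mathcal{M}_i$. $\textsc{LPT-Rebalance}$: let $B_{\min}$ be a bag of minimum processing time; let $\mathcal{M}_{\max}$ be a collection containing a bag with at least two jobs of maximum processing time among such bags; move $B_{\min}$ into $\mathcal{M}_{\max}$; let $J$ be all jobs of $\mathcal{M}_{\max}$, $\ell=|\mathcal{M}_{\max}|$; redistribute $J$ into $\ell$ new bags by LPT (jobs in nonincreasing order of processing time, each to a currently least loaded bag), replacing the bags of $\mathcal{M}_{\max}$. At termination: $b_{\max}=\max\{p(B):B\in\mathcal{B}_{\textsc{IPR}},|B|\ge2\}$; $\mathcal{M}_{\max}$ is a collection containing a bag with at least two jobs and processing time $b_{\max}$; $W=\sum_{B\in\mathcal{M}_{\max}}p(B)$; $\ell=|\mathcal{M}_{\max}|$.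
   Formalization: The processing times $p_j$, the predicted speeds $\hat s_i$ and the parameters α and ε take values in ℚ. -}

module Defs where

open import Data.Nat as ℕ using (ℕ; suc)
open import Data.Fin as Fin using (Fin)
open import Data.Bool using (if_then_else_)
open import Data.List using (List; []; _∷_; _++_; [_]; length; concat; map; foldr; allFin; lookup; removeAt)
open import Data.Vec as Vec using (Vec; replicate; toList; _[_]%=_)
open import Data.List.Relation.Binary.Permutation.Propositional using (_↭_)
open import Data.List.Relation.Unary.AllPairs using (AllPairs)
open import Data.Rational using (ℚ; _+_; _*_; _÷_; _≤_; _<_; 0ℚ; 1ℚ; Positive)
open import Data.Rational.Properties using (pos⇒nonZero)
open import Data.Product using (Σ; ∃; _×_)
open import Relation.Nullary using (¬_; does)
open import Relation.Binary.PropositionalEquality using (_≡_)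

-- Jobs are Fin n, machines are Fin m.  A bag is a (finite) list of jobs.
Bag : ℕ → Set
Bag n = List (Fin n)

pB : ∀ {n} → (Fin n → ℚ) → Bag n → ℚ
pB p B = foldr (λ j acc → p j + acc) 0ℚ B

_÷⟨_⟩_ : ℚ → (s : ℚ) → Positive s → ℚ
(P ÷⟨ s ⟩ sp) = (P ÷ s) {{pos⇒nonZero s {{sp}}}}

IsMaxOf : {I : Set} → (I → ℚ) → ℚ → Set
IsMaxOf {I} f v = (Σ I λ i → f i ≡ v) × (∀ i → f i ≤ v)

IsMinOf : {I : Set} → (I → ℚ) → ℚ → Set
IsMinOf {I} f v = (Σ I λ i → f i ≡ v) × (∀ i → v ≤ f i)

loadσ : ∀ {n m} → (Fin n → ℚ) → (Fin n → Fin m) → Fin m → ℚ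
loadσ {n} p σ i = pB p (Data.List.filter (λ j → σ j Fin.≟ i) (allFin n))

IsMakespan : ∀ {n m} → (Fin n → ℚ) → (s : Fin m → ℚ) → (∀ i → Positive (s i)) →
             (Fin n → Fin m) → ℚ → Set
IsMakespan p s sp σ v = IsMaxOf (λ i → (loadσ p σ i ÷⟨ s i ⟩ sp i)) v

IsOpt : ∀ {n m} → (Fin n → ℚ) → (s : Fin m → ℚ) → (∀ i → Positive (s i)) → ℚ → Set
IsOpt {n} {m} p s sp o =
  (Σ (Fin n → Fin m) λ σ → IsMakespan p s sp σ o) ×
  (∀ σ v → IsMakespan p s sp σ v → o ≤ v)

-- Configurations: collection 𝓜_i (a list of bags) for every machine i

Config : ℕ → ℕ → Set
Config n m = Fin m → List (Bag n)

BagPos : ∀ {n m} → Config n m → Set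
BagPos {m = m} M = Σ (Fin m) λ i → Fin (length (M i))

bagAt : ∀ {n m} (M : Config n m) → BagPos M → Bag n
bagAt M (i Data.Product., k) = lookup (M i) k

collLoad : ∀ {n m} → (Fin n → ℚ) → Config n m → Fin m → ℚ
collLoad p M i = foldr (λ B acc → pB p B + acc) 0ℚ (M i)

-- loop condition of step 2:
--   max{p(B) : |B| ≥ 2} > ρ · min{p(B)}, i.e. some bag with ≥ 2 jobs has
--   processing time larger than ρ times the processing time of some bag
LoopCond : ∀ {n m} → (Fin n → ℚ) → ℚ → Config n m → Set
LoopCond p ρ M =
  Σ (BagPos M) λ x → Σ (BagPos M) λ y →
    (2 ℕ.≤ length (bagAt M x)) × (ρ * pB p (bagAt M y) < pB p (bagAt M x))

-- move bag k of collection i into collection c (no-op if i = c)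
moveBag : ∀ {n m} (M : Config n m) (i : Fin m) → Fin (length (M i)) → Fin m → Config n m
moveBag M i k c x =
  if does (x Fin.≟ c)
  then (if does (i Fin.≟ c) then M c else M c ++ [ lookup (M i) k ])
  else (if does (x Fin.≟ i) then removeAt (M i) k else M x)

-- one run of LPT: jobs (already in the given order) are placed one by one
-- into a currently least loaded bag (ties broken arbitrarily)
data LPTRun {n ℓ} (p : Fin n → ℚ) : Vec (Bag n) ℓ → List (Fin n) → Vec (Bag n) ℓ → Set where
  done : ∀ {bs} → LPTRun p bs [] bs
  step : ∀ {bs j js out} (k : Fin ℓ) →
         (∀ k' → pB p (Vec.lookup bs k) ≤ pB p (Vec.lookup bs k')) →
         LPTRun p (bs [ k ]%= (_++ [ j ])) js out →
         LPTRun p bs (j ∷ js) out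

-- LPT(J) into ℓ bags: sort J in nonincreasing order of processing time
-- (ties arbitrary), then run LPT starting from ℓ empty bags
IsLPT : ∀ {n} → (Fin n → ℚ) → (ℓ : ℕ) → List (Fin n) → Vec (Bag n) ℓ → Set
IsLPT {n} p ℓ J out =
  Σ (List (Fin n)) λ js →
    (js ↭ J) × AllPairs (λ a b → p b ≤ p a) js × LPTRun p (replicate ℓ []) js out

setColl : ∀ {n m} → Config n m → Fin m → List (Bag n) → Config n m
setColl M c bs x = if does (x Fin.≟ c) then bs else M x

-- LPT-Rebalance (all tie-breaking choices allowed): M ⟶ M'
data Rebalance {n m} (p : Fin n → ℚ) (M : Config n m) : Config n m → Set where
  rebalance :
    -- B_min: a bag of minimum processing time (bag k of collection i)
    (i : Fin m) (k : Fin (length (M i))) →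
    (∀ y → pB p (lookup (M i) k) ≤ pB p (bagAt M y)) →
    -- 𝓜_max = collection c containing a bag (index k₂) with ≥ 2 jobs of
    -- maximum processing time among bags with ≥ 2 jobs
    (c : Fin m) (k₂ : Fin (length (M c))) →
    2 ℕ.≤ length (lookup (M c) k₂) →
    (∀ y → 2 ℕ.≤ length (bagAt M y) → pB p (bagAt M y) ≤ pB p (lookup (M c) k₂)) →
    -- redistribute all jobs of the enlarged 𝓜_max by LPT into ℓ = |𝓜_max| bags
    (out : Vec (Bag n) (length (moveBag M i k c c))) →
    IsLPT p (length (moveBag M i k c c)) (concat (moveBag M i k c c)) out →
    Rebalance p M (setColl (moveBag M i k c) c (toList out))

Exceeds : ∀ {n m} → (Fin n → ℚ) → (s : Fin m → ℚ) → (∀ i → Positive (s i)) →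
          ℚ → ℚ → Config n m → Set
Exceeds p s sp α optC M' =
  Σ ℚ λ v → IsMaxOf (λ i → (collLoad p M' i ÷⟨ s i ⟩ sp i)) v × ((1ℚ + α) * optC < v)

-- step 2 of IPR: Loop M Mf means that the while loop started in
-- configuration M can return configuration Mf
data Loop {n m} (p : Fin n → ℚ) (s : Fin m → ℚ) (sp : ∀ i → Positive (s i))
            (α ρ optC : ℚ) : Config n m → Config n m → Set where
  exit   : ∀ {M} → ¬ LoopCond p ρ M → Loop p s sp α ρ optC M M
  reject : ∀ {M M'} → LoopCond p ρ M → Rebalance p M M' →
           Exceeds p s sp α optC M' → Loop p s sp α ρ optC M M
  accept : ∀ {M M' Mf} → LoopCond p ρ M → Rebalance p M M' →
           ¬ Exceeds p s sp α optC M' → Loop p s sp α ρ optC M' Mf →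
           Loop p s sp α ρ optC M Mf

-- the full algorithm IPR: Mf is a possible final configuration of
-- IPR(p, ŝ, α, ε, ρ) (bags returned are the bags of Mf)
IPR : ∀ {n m} (p : Fin n → ℚ) (s : Fin m → ℚ) (sp : ∀ i → Positive (s i))
      (α ε ρ : ℚ) → Config n m → Set
IPR {n} {m} p s sp α ε ρ Mf =
  Σ (Fin m → Bag n) λ B → Σ ℚ λ o → Σ ℚ λ optC →
    (concat (map B (allFin m)) ↭ allFin n) ×
    (∀ i i' → i Fin.≤ i' → pB p (B i') ≤ pB p (B i)) ×
    IsOpt p s sp o ×
    IsMaxOf (λ i → (pB p (B i) ÷⟨ s i ⟩ sp i)) optC ×
    optC ≤ (1ℚ + ε) * o ×
    Loop p s sp α ρ optC (λ i → [ B i ]) Mf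

{-# OPTIONS --safe #-}
module Submission where

-- Whenever LPT puts a job j into a bag that already holds a job, j is no
-- larger than that job, so the bag ends at most twice its load at that
-- moment; being a least loaded bag, that load is at most the final load of
-- every bag of the collection.  Hence every bag B with two or more jobs
-- satisfies p(B) ≤ 2 p(B') for all bags B' of its collection, a property
-- that holds for the singleton collections of step 1 and survives every
-- LPT-Rebalance.  Summing p(B) ≤ 2 p(B') over the ℓ - 1 other bags of the
-- collection and adding 2 p(B) to both sides gives (ℓ + 1) p(B) ≤ 2 W.

open import Defs
open import Data.Nat as ℕ using (ℕ; suc; s≤s)
import Data.Nat.Properties as ℕ
open import Data.Integer as ℤ using (ℤ; +_)
open import Data.Fin as Fin using (Fin)
open import Data.List using (List; []; _∷_; _++_; [_]; foldr; length; lookup; removeAt)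
open import Data.List.Membership.Propositional using (_∈_)
open import Data.List.Membership.Propositional.Properties using (∈-++⁻; ∈-lookup)
open import Data.List.Relation.Binary.Subset.Propositional using (_⊆_)
open import Data.List.Relation.Unary.All as All using (All; []; _∷_)
open import Data.List.Relation.Unary.AllPairs using (AllPairs; _∷_)
open import Data.List.Relation.Unary.Any using (here; there)
open import Data.Vec as Vec using (Vec; toList; replicate; _[_]%=_)
open import Data.Vec.Properties using (lookup∘updateAt; lookup∘updateAt′; lookup-replicate)
open import Data.Vec.Membership.Propositional.Properties using (∈-toList⁻)
import Data.Vec.Relation.Unary.Any as VecAny
open import Data.Vec.Relation.Unary.Any.Properties using (lookup-index)
open import Data.Rational using (ℚ; toℚᵘ; _/_; _+_; _*_; _≤_; _<_; 0ℚ; 1ℚ; Positive)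
open import Data.Rational.Properties
  using (≤-refl; ≤-trans; ≤-reflexive; +-mono-≤; +-monoʳ-≤; +-identityˡ; +-identityʳ; +-assoc;
         *-zeroˡ; *-identityˡ; *-distribʳ-+; *-assoc; *-cancelˡ-≤-pos; normalize-pos;
         toℚᵘ-injective; toℚᵘ-fromℚᵘ; +-0-commutativeMonoid; toℚᵘ-homo-+; toℚᵘ-homo-*; module ≤-Reasoning)
open import Data.Rational.Base using (+-0-rawMonoid)
open import Algebra.Bundles using (CommutativeMonoid)
open import Algebra.Properties.CommutativeSemigroup
  (CommutativeMonoid.commutativeSemigroup +-0-commutativeMonoid) using () renaming (interchange to +-interchange)
import Data.Rational.Unnormalised as ℚᵘ
import Data.Rational.Unnormalised.Properties as ℚᵘ
open import Data.Integer.Solver using () renaming (module +-*-Solver to ℤ-Solver)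
open import Algebra.Definitions.RawMonoid +-0-rawMonoid using (_×_)
open import Data.Product using (_,_)
open import Data.Sum using (inj₁; inj₂)
open import Relation.Nullary using (yes; no)
open import Relation.Binary.PropositionalEquality
  using (_≡_; _≢_; refl; sym; trans; cong; cong₂; subst; subst₂; module ≡-Reasoning)

fromℕ-suc : ∀ n → + suc n / 1 ≡ 1ℚ + + n / 1
fromℕ-suc n = toℚᵘ-injective (begin
  toℚᵘ (+ suc n / 1)                    ≈⟨ toℚᵘ-fromℚᵘ (ℚᵘ.mkℚᵘ (+ suc n) 0) ⟩
  ℚᵘ.mkℚᵘ (+ suc n) 0                   ≈⟨ ℚᵘ.*≡* (solve 1 (λ x → (con (+ 1) :+ x) :* con (+ 1) :=
                                             (con (+ 1) :* con (+ 1) :+ x :* con (+ 1)) :* con (+ 1)) refl (+ n)) ⟩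
  ℚᵘ.mkℚᵘ (+ 1) 0 ℚᵘ.+ ℚᵘ.mkℚᵘ (+ n) 0  ≈⟨ ℚᵘ.+-cong (toℚᵘ-fromℚᵘ (ℚᵘ.mkℚᵘ (+ 1) 0)) (toℚᵘ-fromℚᵘ (ℚᵘ.mkℚᵘ (+ n) 0)) ⟨
  toℚᵘ 1ℚ ℚᵘ.+ toℚᵘ (+ n / 1)           ≈⟨ toℚᵘ-homo-+ 1ℚ (+ n / 1) ⟨
  toℚᵘ (1ℚ + + n / 1)                   ∎)
  where open ℚᵘ.≃-Reasoning; open ℤ-Solver

*-/-cancel : ∀ (i : ℤ) d → (+ suc d / 1) * (i / suc d) ≡ i / 1
*-/-cancel i d = toℚᵘ-injective (begin
  toℚᵘ ((+ suc d / 1) * (i / suc d))        ≈⟨ toℚᵘ-homo-* (+ suc d / 1) (i / suc d) ⟩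
  toℚᵘ (+ suc d / 1) ℚᵘ.* toℚᵘ (i / suc d)  ≈⟨ ℚᵘ.*-cong (toℚᵘ-fromℚᵘ (ℚᵘ.mkℚᵘ (+ suc d) 0)) (toℚᵘ-fromℚᵘ (ℚᵘ.mkℚᵘ i d)) ⟩
  ℚᵘ.mkℚᵘ (+ suc d) 0 ℚᵘ.* ℚᵘ.mkℚᵘ i d      ≈⟨ ℚᵘ.*≡* (trans
                                                 (solve 2 (λ x y → (x :* y) :* con (+ 1) := y :* x) refl (+ suc d) i)
                                                 (cong (λ e → i ℤ.* + suc e) (sym (ℕ.+-identityʳ d)))) ⟩
  ℚᵘ.mkℚᵘ i 0                               ≈⟨ toℚᵘ-fromℚᵘ (ℚᵘ.mkℚᵘ i 0) ⟨
  toℚᵘ (i / 1)                              ∎)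
  where open ℚᵘ.≃-Reasoning; open ℤ-Solver

fromℕ-*≡× : ∀ n x → (+ n / 1) * x ≡ n × x
fromℕ-*≡× 0 x = *-zeroˡ x
fromℕ-*≡× (suc n) x = begin
  (+ suc n / 1) * x        ≡⟨ cong (_* x) (fromℕ-suc n) ⟩
  (1ℚ + + n / 1) * x       ≡⟨ *-distribʳ-+ x 1ℚ (+ n / 1) ⟩
  1ℚ * x + (+ n / 1) * x   ≡⟨ cong₂ _+_ (*-identityˡ x) (fromℕ-*≡× n x) ⟩
  x + n × x                ∎
  where open ≡-Reasoning

×-≤⇒≤-/ : ∀ k d {x y} → suc d × x ≤ k × y → x ≤ (+ k / suc d) * y
×-≤⇒≤-/ k d {x} {y} h = *-cancelˡ-≤-pos (+ suc d / 1) {{normalize-pos (suc d) 1}} (begin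
  (+ suc d / 1) * x                     ≡⟨ fromℕ-*≡× (suc d) x ⟩
  suc d × x                             ≤⟨ h ⟩
  k × y                                 ≡⟨ fromℕ-*≡× k y ⟨
  (+ k / 1) * y                         ≡⟨ cong (_* y) (*-/-cancel (+ k) d) ⟨
  ((+ suc d / 1) * (+ k / suc d)) * y   ≡⟨ *-assoc (+ suc d / 1) (+ k / suc d) y ⟩
  (+ suc d / 1) * ((+ k / suc d) * y)   ∎)
  where open ≤-Reasoning

p≤p+q : ∀ p {q} → 0ℚ ≤ q → p ≤ p + q
p≤p+q p {q} 0≤q = begin
  p        ≡⟨ +-identityʳ p ⟨
  p + 0ℚ   ≤⟨ +-monoʳ-≤ p 0≤q ⟩
  p + q    ∎
  where open ≤-Reasoning

p≤q+p : ∀ p {q} → 0ℚ ≤ q → p ≤ q + p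
p≤q+p p {q} 0≤q = begin
  p        ≡⟨ +-identityˡ p ⟨
  0ℚ + p   ≤⟨ +-mono-≤ 0≤q ≤-refl ⟩
  q + p    ∎
  where open ≤-Reasoning

module _ {A : Set} (f : A → ℚ) where

  sumOf : List A → ℚ
  sumOf xs = foldr (λ x acc → f x + acc) 0ℚ xs

  sumOf-∷ʳ : ∀ xs x → sumOf (xs ++ [ x ]) ≡ sumOf xs + f x
  sumOf-∷ʳ [] x = trans (+-identityʳ (f x)) (sym (+-identityˡ (f x)))
  sumOf-∷ʳ (y ∷ xs) x = trans (cong (λ s → f y + s) (sumOf-∷ʳ xs x)) (sym (+-assoc (f y) (sumOf xs) (f x)))

  module _ (f≥0 : ∀ x → 0ℚ ≤ f x) where

    sumOf-nonNeg : ∀ xs → 0ℚ ≤ sumOf xs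
    sumOf-nonNeg [] = ≤-refl
    sumOf-nonNeg (x ∷ xs) = ≤-trans (sumOf-nonNeg xs) (p≤q+p (sumOf xs) (f≥0 x))

    ∈⇒≤-sumOf : ∀ {x xs} → x ∈ xs → f x ≤ sumOf xs
    ∈⇒≤-sumOf {xs = x ∷ xs} (here refl) = p≤p+q (f x) (sumOf-nonNeg xs)
    ∈⇒≤-sumOf {xs = y ∷ xs} (there x∈xs) = ≤-trans (∈⇒≤-sumOf x∈xs) (p≤q+p (sumOf xs) (f≥0 y))

  length×≤sumOf-double : ∀ {b} xs → All (λ y → b ≤ f y + f y) xs → length xs × b ≤ sumOf xs + sumOf xs
  length×≤sumOf-double [] [] = ≤-refl
  length×≤sumOf-double {b} (y ∷ ys) (b≤2fy ∷ bs) = begin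
    b + length ys × b                       ≤⟨ +-mono-≤ b≤2fy (length×≤sumOf-double ys bs) ⟩
    (f y + f y) + (sumOf ys + sumOf ys)     ≡⟨ +-interchange (f y) (f y) (sumOf ys) (sumOf ys) ⟩
    (f y + sumOf ys) + (f y + sumOf ys)     ∎
    where open ≤-Reasoning

  suc-length×≤sumOf-double : ∀ {x} xs → x ∈ xs → All (λ y → f x ≤ f y + f y) xs →
                             suc (length xs) × f x ≤ sumOf xs + sumOf xs
  suc-length×≤sumOf-double {x} (.x ∷ ys) (here refl) (_ ∷ bs) = begin
    f x + (f x + length ys × f x)           ≤⟨ +-monoʳ-≤ (f x) (+-monoʳ-≤ (f x) (length×≤sumOf-double ys bs)) ⟩
    f x + (f x + (sumOf ys + sumOf ys))     ≡⟨ +-assoc (f x) (f x) _ ⟨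
    (f x + f x) + (sumOf ys + sumOf ys)     ≡⟨ +-interchange (f x) (f x) (sumOf ys) (sumOf ys) ⟩
    (f x + sumOf ys) + (f x + sumOf ys)     ∎
    where open ≤-Reasoning
  suc-length×≤sumOf-double {x} (y ∷ ys) (there x∈ys) (fx≤2fy ∷ bs) = begin
    f x + suc (length ys) × f x             ≤⟨ +-mono-≤ fx≤2fy (suc-length×≤sumOf-double ys x∈ys bs) ⟩
    (f y + f y) + (sumOf ys + sumOf ys)     ≡⟨ +-interchange (f y) (f y) (sumOf ys) (sumOf ys) ⟩
    (f y + sumOf ys) + (f y + sumOf ys)     ∎
    where open ≤-Reasoning

removeAt-⊆ : ∀ {A : Set} (xs : List A) k → removeAt xs k ⊆ xs
removeAt-⊆ (x ∷ xs) Fin.zero y∈ = there y∈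
removeAt-⊆ (x ∷ xs) (Fin.suc k) (here refl) = here refl
removeAt-⊆ (x ∷ xs) (Fin.suc k) (there y∈) = there (removeAt-⊆ xs k y∈)

module Bags {n : ℕ} (p : Fin n → ℚ) (p≥0 : ∀ j → 0ℚ ≤ p j) where

  Balanced : List (Bag n) → Set
  Balanced bags = ∀ {B B'} → B ∈ bags → B' ∈ bags → 2 ℕ.≤ length B → pB p B ≤ pB p B' + pB p B'

  Balanced-⊆ : ∀ {xs ys} → ys ⊆ xs → Balanced xs → Balanced ys
  Balanced-⊆ ys⊆xs bal B∈ B'∈ = bal (ys⊆xs B∈) (ys⊆xs B'∈)

  Balanced-[_] : ∀ B → Balanced [ B ]
  Balanced-[ B ] (here refl) (here refl) _ = p≤p+q (pB p B) (sumOf-nonNeg p p≥0 B)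

  Balanced⇒≤-/ : ∀ {B bags} → Balanced bags → B ∈ bags → 2 ℕ.≤ length B →
                 pB p B ≤ (+ 2 / suc (length bags)) * sumOf (pB p) bags
  Balanced⇒≤-/ {B} {bags} bal B∈ 2≤|B| = ×-≤⇒≤-/ 2 (length bags) (begin
    suc (length bags) × pB p B   ≤⟨ suc-length×≤sumOf-double (pB p) bags B∈ (All.tabulate (λ B'∈ → bal B∈ B'∈ 2≤|B|)) ⟩
    W + W                        ≡⟨ cong (λ w → W + w) (+-identityʳ W) ⟨
    2 × W                        ∎)
    where open ≤-Reasoning
          W = sumOf (pB p) bags

  ∷ʳ-≤-double : ∀ B j → (∀ {j'} → j' ∈ B → p j ≤ p j') → 2 ℕ.≤ length (B ++ [ j ]) →
                pB p (B ++ [ j ]) ≤ pB p B + pB p B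
  ∷ʳ-≤-double [] j _ (s≤s ())
  ∷ʳ-≤-double (j₀ ∷ B) j j≤ _ = begin
    pB p (j₀ ∷ B ++ [ j ])          ≡⟨ sumOf-∷ʳ p (j₀ ∷ B) j ⟩
    pB p (j₀ ∷ B) + p j             ≤⟨ +-monoʳ-≤ (pB p (j₀ ∷ B)) j≤pB ⟩
    pB p (j₀ ∷ B) + pB p (j₀ ∷ B)   ∎
    where open ≤-Reasoning
          j≤pB : p j ≤ pB p (j₀ ∷ B)
          j≤pB = ≤-trans (j≤ (here refl)) (∈⇒≤-sumOf p p≥0 {xs = j₀ ∷ B} (here refl))

  module _ {ℓ : ℕ} where

    BalancedVec : Vec (Bag n) ℓ → Set
    BalancedVec bs = ∀ a a' → 2 ℕ.≤ length (Vec.lookup bs a) →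
                     pB p (Vec.lookup bs a) ≤ pB p (Vec.lookup bs a') + pB p (Vec.lookup bs a')

    NoLargerThanPlaced : List (Fin n) → Vec (Bag n) ℓ → Set
    NoLargerThanPlaced js bs = ∀ a {j'} → j' ∈ Vec.lookup bs a → All (λ j → p j ≤ p j') js

    BalancedVec⇒Balanced : ∀ {bs} → BalancedVec bs → Balanced (toList bs)
    BalancedVec⇒Balanced {bs} bal B∈ B'∈ =
      subst₂ (λ B B' → 2 ℕ.≤ length B → pB p B ≤ pB p B' + pB p B')
             (sym (lookup-index (∈-toList⁻ B∈))) (sym (lookup-index (∈-toList⁻ B'∈)))
             (bal (VecAny.index (∈-toList⁻ B∈)) (VecAny.index (∈-toList⁻ B'∈)))

    module Place (bs : Vec (Bag n) ℓ) (k : Fin ℓ) (j : Fin n) where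

      bs' : Vec (Bag n) ℓ
      bs' = bs [ k ]%= (_++ [ j ])

      lookup-placed : Vec.lookup bs' k ≡ Vec.lookup bs k ++ [ j ]
      lookup-placed = lookup∘updateAt k bs

      lookup-other : ∀ {a} → a ≢ k → Vec.lookup bs' a ≡ Vec.lookup bs a
      lookup-other {a} a≢k = lookup∘updateAt′ a k a≢k bs

      grows : ∀ a → pB p (Vec.lookup bs a) ≤ pB p (Vec.lookup bs' a)
      grows a with a Fin.≟ k
      ... | yes refl = begin
        pB p (Vec.lookup bs a)              ≤⟨ p≤p+q _ (p≥0 j) ⟩
        pB p (Vec.lookup bs a) + p j        ≡⟨ sumOf-∷ʳ p (Vec.lookup bs a) j ⟨
        pB p (Vec.lookup bs a ++ [ j ])     ≡⟨ cong (pB p) lookup-placed ⟨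
        pB p (Vec.lookup bs' a)             ∎
        where open ≤-Reasoning
      ... | no a≢k = ≤-reflexive (cong (pB p) (sym (lookup-other a≢k)))

      balanced : (∀ a' → pB p (Vec.lookup bs k) ≤ pB p (Vec.lookup bs a')) → BalancedVec bs →
                 (∀ {j'} → j' ∈ Vec.lookup bs k → p j ≤ p j') → BalancedVec bs'
      balanced least bal j≤ a a' 2≤ with a Fin.≟ k
      ... | yes refl = begin
        pB p (Vec.lookup bs' a)                               ≡⟨ cong (pB p) lookup-placed ⟩
        pB p (Vec.lookup bs a ++ [ j ])                       ≤⟨ ∷ʳ-≤-double _ j j≤ (subst (λ B → 2 ℕ.≤ length B) lookup-placed 2≤) ⟩
        pB p (Vec.lookup bs a) + pB p (Vec.lookup bs a)       ≤⟨ +-mono-≤ (≤-trans (least a') (grows a')) (≤-trans (least a') (grows a')) ⟩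
        pB p (Vec.lookup bs' a') + pB p (Vec.lookup bs' a')   ∎
        where open ≤-Reasoning
      ... | no a≢k = begin
        pB p (Vec.lookup bs' a)                               ≡⟨ cong (pB p) (lookup-other a≢k) ⟩
        pB p (Vec.lookup bs a)                                ≤⟨ bal a a' (subst (λ B → 2 ℕ.≤ length B) (lookup-other a≢k) 2≤) ⟩
        pB p (Vec.lookup bs a') + pB p (Vec.lookup bs a')     ≤⟨ +-mono-≤ (grows a') (grows a') ⟩
        pB p (Vec.lookup bs' a') + pB p (Vec.lookup bs' a')   ∎
        where open ≤-Reasoning

      noLargerThanPlaced : ∀ {js} → All (λ j' → p j' ≤ p j) js → NoLargerThanPlaced (j ∷ js) bs →
                           NoLargerThanPlaced js bs'
      noLargerThanPlaced js≤j small a {j'} j'∈ with a Fin.≟ k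
      ... | yes refl with ∈-++⁻ (Vec.lookup bs a) (subst (j' ∈_) lookup-placed j'∈)
      ...   | inj₁ j'∈old = All.tail (small a j'∈old)
      ...   | inj₂ (here refl) = js≤j
      noLargerThanPlaced js≤j small a {j'} j'∈ | no a≢k = All.tail (small a (subst (j' ∈_) (lookup-other a≢k) j'∈))

    LPTRun-balanced : ∀ {bs js out} → LPTRun p bs js out → AllPairs (λ a b → p b ≤ p a) js →
                      BalancedVec bs → NoLargerThanPlaced js bs → BalancedVec out
    LPTRun-balanced done _ bal _ = bal
    LPTRun-balanced {bs} (step {j = j} k least run) (js≤j ∷ sorted) bal small =
      LPTRun-balanced run sorted (balanced least bal (λ j'∈ → All.head (small k j'∈))) (noLargerThanPlaced js≤j small)
      where open Place bs k j

    IsLPT-balanced : ∀ {J out} → IsLPT p ℓ J out → Balanced (toList out)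
    IsLPT-balanced (js , _ , sorted , run) = BalancedVec⇒Balanced (LPTRun-balanced run sorted empty-balanced empty-small)
      where
      empty-balanced : BalancedVec (replicate ℓ [])
      empty-balanced a _ 2≤ with subst (λ B → 2 ℕ.≤ length B) (lookup-replicate a []) 2≤
      ... | ()

      empty-small : NoLargerThanPlaced js (replicate ℓ [])
      empty-small a {j'} j'∈ with subst (j' ∈_) (lookup-replicate a []) j'∈
      ... | ()

  BalancedConfig : ∀ {m} → Config n m → Set
  BalancedConfig M = ∀ i → Balanced (M i)

  Rebalance-balanced : ∀ {m} {M M' : Config n m} → Rebalance p M M' → BalancedConfig M → BalancedConfig M'
  Rebalance-balanced {M = M} (rebalance i k _ c _ _ _ _ lpt) bal x with x Fin.≟ c
  ... | yes refl = IsLPT-balanced lpt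
  ... | no _ with x Fin.≟ i
  ...   | yes refl = Balanced-⊆ (removeAt-⊆ (M x) k) (bal x)
  ...   | no _ = bal x

  Loop-balanced : ∀ {m} {s : Fin m → ℚ} {sp α ρ optC} {M Mf : Config n m} →
                  Loop p s sp α ρ optC M Mf → BalancedConfig M → BalancedConfig Mf
  Loop-balanced (exit _) bal = bal
  Loop-balanced (reject _ _ _) bal = bal
  Loop-balanced (accept _ reb _ loop) bal = Loop-balanced loop (Rebalance-balanced reb bal)

lemma7 : ∀ {n m} (p : Fin n → ℚ) (s : Fin m → ℚ) (sp : ∀ i → Positive (s i))
         (α ε : ℚ) (Mf : Config n m) →
         (∀ j → 0ℚ ≤ p j) →
         (∀ i i' → i Fin.≤ i' → s i' ≤ s i) →
         0ℚ < α → α < 1ℚ → 0ℚ < ε → ε < 1ℚ →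
         IPR p s sp α ε ((+ 4) / 1) Mf →
         (c : Fin m) (k : Fin (length (Mf c))) →
         2 ℕ.≤ length (lookup (Mf c) k) →
         (∀ y → 2 ℕ.≤ length (bagAt Mf y) → pB p (bagAt Mf y) ≤ pB p (lookup (Mf c) k)) →
         pB p (lookup (Mf c) k) ≤ ((+ 2) / suc (length (Mf c))) * collLoad p Mf c
lemma7 p s sp α ε Mf p≥0 _ _ _ _ _ (B , _ , _ , _ , _ , _ , _ , _ , loop) c k 2≤ _ =
  Balanced⇒≤-/ (Loop-balanced loop (λ i → Balanced-[ B i ]) c) (∈-lookup k) 2≤
  where open Bags p p≥0
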